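{- Let $G$ be a graph with $n$ vertices and $k$ an integer such that (i) $0<k\leq \frac{1}{60}{\sf ad}(G)$, (ii) $\delta(G)\geq \frac{1}{2}{\sf ad}(G)$, and (iii) ${\sf ad}(G)+k>n$. Let $S$ be a potentially cyclable set of at most $k$ pairs of distinct vertices of $G$. Then $G+S$ has a Hamiltonian cycle containing every pair of $S$ as an edge.
   Context: All graphs are finite, simple and undirected. ${\sf ad}(G)=2|E(G)|/|V(G)|$ and $\delta(G)$ is the minimum degree. For a set $S$ of pairs of distinct vertices of $G$ (each pair may or may not be an edge of $G$), $G+S$ is the graph $(V(G),E(G)\cup S)$. $S$ is potentially cyclable if the graph $(V(G),S)$ is a linear forest, i.e., each of its connected components is a path. A Hamiltonian cycle is a cycle containing all vertices. -}

module Defs where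

open import Data.Nat using (ℕ; zero; suc; _+_; _*_; _≤_; _<_; _<ᵇ_)
open import Data.Fin using (Fin; toℕ)
open import Data.Bool using (Bool; true; false; if_then_else_; _∧_)
open import Data.List using (List; []; _∷_; _++_; [_]; map; length; zip; allFin)
open import Data.Nat.ListAction using (sum)
open import Data.List.Membership.Propositional using (_∈_)
open import Data.List.Relation.Unary.Unique.Propositional using (Unique)
open import Data.Product using (_×_; _,_)
open import Data.Sum using (_⊎_)
open import Relation.Binary.PropositionalEquality using (_≡_; refl)
open import Relation.Nullary using (¬_)

record Graph (n : ℕ) : Set where
  field
    adj    : Fin n → Fin n → Bool
    sym    : ∀ u v → adj u v ≡ adj v u
    irrefl : ∀ v → adj v v ≡ false
open Graph public

b2n : Bool → ℕ
b2n true  = 1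
b2n false = 0

deg : ∀ {n} → Graph n → Fin n → ℕ
deg G v = sum (map (λ u → b2n (adj G v u)) (allFin _))

numEdges : ∀ {n} → Graph n → ℕ
numEdges {n} G =
  sum (map (λ u → sum (map (λ v → b2n ((toℕ u <ᵇ toℕ v) ∧ adj G u v)) (allFin n))) (allFin n))

_⊕_ : ∀ {n} → Graph n → Graph n → Graph n
adj    (G ⊕ S) u v = if adj G u v then true else adj S u v
sym    (G ⊕ S) u v rewrite sym G u v | sym S u v = refl
irrefl (G ⊕ S) v rewrite irrefl G v | irrefl S v = refl

cycPairs : ∀ {A : Set} → List A → List (A × A)
cycPairs []       = []
cycPairs (x ∷ xs) = zip (x ∷ xs) (xs ++ [ x ])

CycleEdge : ∀ {A : Set} → List A → A → A → Set
CycleEdge c u v = ((u , v) ∈ cycPairs c) ⊎ ((v , u) ∈ cycPairs c)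

IsCycle : ∀ {n} → Graph n → List (Fin n) → Set
IsCycle G c = (3 ≤ length c) × Unique c
            × (∀ u v → (u , v) ∈ cycPairs c → adj G u v ≡ true)

IsHamCycle : ∀ {n} → Graph n → List (Fin n) → Set
IsHamCycle G c = IsCycle G c × (∀ v → v ∈ c)

IsLinearForest : ∀ {n} → Graph n → Set
IsLinearForest G = (∀ v → deg G v ≤ 2) × (∀ c → ¬ IsCycle G c)

-- Starting from any tour, first make every pair of S a link: since S is a linear forest,
-- an uncovered pair u–v of S can be made a link by a 3-opt exchange that keeps all links
-- lying in S. Then remove the bad links (non-edges of G + S) one at a time. A bad link a–b is
-- replaced by G-edges a–x and b–y for a link x–y outside S, which exists once
-- deg a + deg b > n + 2k, because S accounts for at most 2k links. That degree bound fails
-- only if both a and b are low (2 deg < n + 6k), and by double counting with ad(G) + k > n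
-- fewer than 3k vertices are low; so bad links between low vertices are removed first,
-- using instead a neighbour x of a that is neither low nor on S and whose successor is not
-- low, of which δ ≥ 30k guarantees one.

module Submission where

open import Defs hiding (sym)
open import Data.Nat using (ℕ; zero; suc; _+_; _*_; _∸_; _≤_; _<_; _<ᵇ_; z≤n; s≤s; z<s; NonZero; >-nonZero)
open import Data.Nat.Properties hiding (_≟_)
open import Data.Nat.ListAction using (sum)
open import Data.Nat.ListAction.Properties using (sum-↭; sum-++)
open import Data.Nat.Solver using (module +-*-Solver)
open import Data.Bool using (Bool; true; false; _∧_; not; T)
open import Data.Bool.Properties using (∧-comm; ∧-zeroʳ)
open import Data.Unit using (⊤; tt)
open import Data.Empty using (⊥; ⊥-elim)
open import Data.Fin using (Fin; toℕ; fromℕ<)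
open import Data.Fin.Properties using (toℕ-injective; _≟_)
open import Data.List using (List; []; _∷_; _++_; [_]; map; zip; reverse; length; allFin)
open import Data.List.Properties using (++-assoc; unfold-reverse; map-++; reverse-++; reverse-involutive; ++-identityʳ; ∷-injective; length-tabulate)
open import Data.List.Membership.Propositional using (_∈_)
open import Data.List.Membership.Propositional.Properties using (∈-map⁺; ∈-++⁺ˡ; ∈-++⁺ʳ; ∈-++⁻; ∈-∃++; ∈-allFin)
open import Data.List.Membership.Propositional.Properties.WithK using (unique∧set⇒bag)
open import Data.List.Membership.DecPropositional using (_∈?_)
open import Data.List.Relation.Binary.BagAndSetEquality using (∼bag⇒↭)
open import Data.List.Relation.Binary.Permutation.Propositional using (_↭_; ↭-sym; ↭-trans; ↭-refl; prep; ↭⇒↭ₛ)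
open import Data.List.Relation.Binary.Permutation.Propositional.Properties using (∈-resp-↭; ↭-reverse; ↭-length; ++-comm; ++⁺ˡ; ++⁺ʳ; map⁺; ∷↭∷ʳ)
import Data.List.Relation.Binary.Permutation.Setoid.Properties as ↭ₛ
open import Data.List.Relation.Unary.Any using (here; there)
import Data.List.Relation.Unary.All as All
open import Data.List.Relation.Unary.All.Properties using (++⁻ʳ)
open import Data.List.Relation.Unary.Unique.Propositional using (Unique; _∷_)
open import Data.List.Relation.Unary.Unique.Propositional.Properties using (allFin⁺)
open import Data.Product using (Σ; ∃-syntax; _×_; _,_; proj₁; proj₂; swap; uncurry; map₂)
open import Data.Product.Properties using (≡-dec)
open import Data.Sum using (_⊎_; inj₁; inj₂)
open import Function.Bundles using (mk⇔)
open import Relation.Nullary using (¬_; Dec; yes; no; does)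
open import Relation.Nullary.Decidable using (_⊎-dec_)
open import Relation.Binary.PropositionalEquality hiding ([_])

b2n≤1 : ∀ b → b2n b ≤ 1
b2n≤1 true  = s≤s z≤n
b2n≤1 false = z≤n

module _ {A : Set} where

  sum-map-+ : (f g : A → ℕ) (xs : List A) →
              sum (map (λ x → f x + g x) xs) ≡ sum (map f xs) + sum (map g xs)
  sum-map-+ f g []       = refl
  sum-map-+ f g (x ∷ xs) rewrite sum-map-+ f g xs = +-+-comm (f x) (g x) _ _
    where
    open +-*-Solver
    +-+-comm : ∀ a b c d → a + b + (c + d) ≡ a + c + (b + d)
    +-+-comm = solve 4 (λ a b c d → a :+ b :+ (c :+ d) := a :+ c :+ (b :+ d)) refl

  sum-map-*ˡ : (c : ℕ) (f : A → ℕ) (xs : List A) → sum (map (λ x → c * f x) xs) ≡ c * sum (map f xs)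
  sum-map-*ˡ c f []       = sym (*-zeroʳ c)
  sum-map-*ˡ c f (x ∷ xs) = trans (cong (c * f x +_) (sum-map-*ˡ c f xs)) (sym (*-distribˡ-+ c (f x) _))

  sum-map-*ʳ : (f : A → ℕ) (c : ℕ) (xs : List A) → sum (map (λ x → f x * c) xs) ≡ sum (map f xs) * c
  sum-map-*ʳ f c []       = refl
  sum-map-*ʳ f c (x ∷ xs) = trans (cong (f x * c +_) (sum-map-*ʳ f c xs)) (sym (*-distribʳ-+ c (f x) _))

  sum-map-const : (c : ℕ) (xs : List A) → sum (map (λ _ → c) xs) ≡ length xs * c
  sum-map-const c []       = refl
  sum-map-const c (x ∷ xs) = cong (c +_) (sum-map-const c xs)

  sum-map-mono : (f g : A → ℕ) → (∀ x → f x ≤ g x) → ∀ xs → sum (map f xs) ≤ sum (map g xs)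
  sum-map-mono f g f≤g []       = z≤n
  sum-map-mono f g f≤g (x ∷ xs) = +-mono-≤ (f≤g x) (sum-map-mono f g f≤g xs)

  sum-map-mono-< : (f g : A → ℕ) → (∀ x → f x ≤ g x) → ∀ {x} xs → x ∈ xs → f x < g x →
                   sum (map f xs) < sum (map g xs)
  sum-map-mono-< f g f≤g (y ∷ xs) (here refl) lt = +-mono-<-≤ lt (sum-map-mono f g f≤g xs)
  sum-map-mono-< f g f≤g (y ∷ xs) (there x∈) lt = +-mono-≤-< (f≤g y) (sum-map-mono-< f g f≤g xs x∈ lt)

  ∈⇒≤sum-map : (f : A → ℕ) {x : A} (xs : List A) → x ∈ xs → f x ≤ sum (map f xs)
  ∈⇒≤sum-map f (y ∷ xs) (here refl) = m≤m+n (f y) _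
  ∈⇒≤sum-map f (y ∷ xs) (there x∈) = ≤-trans (∈⇒≤sum-map f xs x∈) (m≤n+m _ (f y))

  sum-map-pos : (f : A → ℕ) (xs : List A) → 0 < sum (map f xs) → ∃[ x ] x ∈ xs × 0 < f x
  sum-map-pos f (x ∷ xs) pos with f x in eq
  ... | suc _ = x , here refl , subst (0 <_) (sym eq) z<s
  ... | zero with sum-map-pos f xs pos
  ...   | y , y∈ , fy>0 = y , there y∈ , fy>0

  sum-map-swap : (f : A → A → ℕ) (xs ys : List A) →
                 sum (map (λ x → sum (map (f x) ys)) xs) ≡ sum (map (λ y → sum (map (λ x → f x y) xs)) ys)
  sum-map-swap f []       ys = sym (sum-map-zero ys)
    where
    sum-map-zero : ∀ zs → sum (map (λ _ → 0) zs) ≡ 0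
    sum-map-zero []       = refl
    sum-map-zero (_ ∷ zs) = sum-map-zero zs
  sum-map-swap f (x ∷ xs) ys = trans (cong (sum (map (f x) ys) +_) (sum-map-swap f xs ys))
                                     (sym (sum-map-+ (f x) (λ y → sum (map (λ x′ → f x′ y) xs)) ys))

  sum-map-cong : {f g : A → ℕ} → (∀ x → f x ≡ g x) → ∀ xs → sum (map f xs) ≡ sum (map g xs)
  sum-map-cong f≡g []       = refl
  sum-map-cong f≡g (x ∷ xs) = cong₂ _+_ (f≡g x) (sum-map-cong f≡g xs)

  count : (A → Bool) → List A → ℕ
  count p xs = sum (map (λ x → b2n (p x)) xs)

  count≤length : ∀ p xs → count p xs ≤ length xs
  count≤length p []       = z≤n
  count≤length p (x ∷ xs) = +-mono-≤ (b2n≤1 (p x)) (count≤length p xs)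

module _ {A : Set} where

  Unique-resp-↭ : ∀ {xs ys : List A} → xs ↭ ys → Unique xs → Unique ys
  Unique-resp-↭ p = ↭ₛ.Unique-resp-↭ (setoid A) (↭⇒↭ₛ p)

  Unique-++⁻ʳ : ∀ (xs : List A) {ys} → Unique (xs ++ ys) → Unique ys
  Unique-++⁻ʳ []       u       = u
  Unique-++⁻ʳ (x ∷ xs) (_ ∷ u) = Unique-++⁻ʳ xs u

  Unique-∷-++⁻ʳ : ∀ {x : A} (xs : List A) {ys} → Unique (x ∷ xs ++ ys) → Unique (x ∷ ys)
  Unique-∷-++⁻ʳ xs (x∉ ∷ u) = ++⁻ʳ xs x∉ ∷ Unique-++⁻ʳ xs u

  Unique-tail : ∀ {x : A} {xs} → Unique (x ∷ xs) → Unique xs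
  Unique-tail (_ ∷ u) = u

  Unique-∷⇒≢ : ∀ {x y : A} {xs} → Unique (x ∷ xs) → y ∈ xs → ¬ x ≡ y
  Unique-∷⇒≢ (x∉ ∷ _) y∈ = All.lookup x∉ y∈

  Unique-++⇒≢ : ∀ (xs : List A) {ys} {x y} → Unique (xs ++ ys) → x ∈ xs → y ∈ ys → ¬ x ≡ y
  Unique-++⇒≢ (z ∷ xs) (z∉ ∷ _) (here refl) y∈ = All.lookup z∉ (∈-++⁺ʳ xs y∈)
  Unique-++⇒≢ (z ∷ xs) (_ ∷ u)  (there x∈)  y∈ = Unique-++⇒≢ xs u x∈ y∈

module _ {A : Set} where

  pathPairs : A → List A → List (A × A)
  pathPairs x []       = []
  pathPairs x (y ∷ ys) = (x , y) ∷ pathPairs y ys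

  lastFrom : A → List A → A
  lastFrom x []       = x
  lastFrom x (y ∷ ys) = lastFrom y ys

  lastFrom-∷ʳ : (x : A) (xs : List A) (y : A) → lastFrom x (xs ++ [ y ]) ≡ y
  lastFrom-∷ʳ x []       y = refl
  lastFrom-∷ʳ x (z ∷ xs) y = lastFrom-∷ʳ z xs y

  lastFrom-∈ : (x : A) (xs : List A) → lastFrom x xs ∈ x ∷ xs
  lastFrom-∈ x []       = here refl
  lastFrom-∈ x (y ∷ xs) = there (lastFrom-∈ y xs)

  pathPairs-++ : (x : A) (xs ys : List A) →
                 pathPairs x (xs ++ ys) ≡ pathPairs x xs ++ pathPairs (lastFrom x xs) ys
  pathPairs-++ x []       ys = refl
  pathPairs-++ x (y ∷ xs) ys = cong ((x , y) ∷_) (pathPairs-++ y xs ys)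

  zip-∷-∷ʳ : (x : A) (xs : List A) (y : A) → zip (x ∷ xs) (xs ++ [ y ]) ≡ pathPairs x (xs ++ [ y ])
  zip-∷-∷ʳ x []       y = refl
  zip-∷-∷ʳ x (z ∷ xs) y = cong ((x , z) ∷_) (zip-∷-∷ʳ z xs y)

  cycPairs-∷ : (x : A) (xs : List A) → cycPairs (x ∷ xs) ≡ pathPairs x (xs ++ [ x ])
  cycPairs-∷ x xs = zip-∷-∷ʳ x xs x

  lastFrom-pathPairs : (x : A) (xs : List A) (y : A) → (lastFrom x xs , y) ∈ pathPairs x (xs ++ [ y ])
  lastFrom-pathPairs x []       y = here refl
  lastFrom-pathPairs x (z ∷ xs) y = there (lastFrom-pathPairs z xs y)

  proj₁-∈-pathPairs : ∀ {u v} (x : A) (xs : List A) (y : A) →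
                      (u , v) ∈ pathPairs x (xs ++ [ y ]) → u ∈ x ∷ xs
  proj₁-∈-pathPairs x []       y (here refl) = here refl
  proj₁-∈-pathPairs x (z ∷ xs) y (here refl) = here refl
  proj₁-∈-pathPairs x (z ∷ xs) y (there p)   = there (proj₁-∈-pathPairs z xs y p)

  reversePairs : List (A × A) → List (A × A)
  reversePairs ps = map swap (reverse ps)

  reversePairs-∷ : (p : A × A) (ps : List (A × A)) → reversePairs (p ∷ ps) ≡ reversePairs ps ++ [ swap p ]
  reversePairs-∷ p ps = trans (cong (map swap) (unfold-reverse p ps)) (map-++ swap (reverse ps) [ p ])

  reverse-pathPairs : (x : A) (xs : List A) → ∃[ ys ]
    reverse (x ∷ xs) ≡ lastFrom x xs ∷ ys × lastFrom (lastFrom x xs) ys ≡ x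
    × pathPairs (lastFrom x xs) ys ≡ reversePairs (pathPairs x xs)
  reverse-pathPairs x []       = [] , refl , refl , refl
  reverse-pathPairs x (y ∷ xs) with reverse-pathPairs y xs
  ... | ys , rev , last , pairs = ys ++ [ x ] , rev′ , lastFrom-∷ʳ _ ys x , pairs′
    where
    open ≡-Reasoning
    rev′ : reverse (x ∷ y ∷ xs) ≡ lastFrom y xs ∷ (ys ++ [ x ])
    rev′ = trans (unfold-reverse x (y ∷ xs)) (cong (_++ [ x ]) rev)
    pairs′ : pathPairs (lastFrom y xs) (ys ++ [ x ]) ≡ reversePairs ((x , y) ∷ pathPairs y xs)
    pairs′ = begin
      pathPairs (lastFrom y xs) (ys ++ [ x ])                      ≡⟨ pathPairs-++ _ ys [ x ] ⟩
      pathPairs (lastFrom y xs) ys ++ [ (lastFrom (lastFrom y xs) ys , x) ] ≡⟨ cong₂ (λ ps z → ps ++ [ (z , x) ]) pairs last ⟩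
      reversePairs (pathPairs y xs) ++ [ (y , x) ]                 ≡⟨ sym (reversePairs-∷ (x , y) (pathPairs y xs)) ⟩
      reversePairs ((x , y) ∷ pathPairs y xs)                      ∎

  ∈-reversePairs⁺ : ∀ {u v : A} (ps : List (A × A)) → (u , v) ∈ ps → (v , u) ∈ reversePairs ps
  ∈-reversePairs⁺ ps m = ∈-map⁺ swap (∈-resp-↭ (↭-sym (↭-reverse ps)) m)

module _ {A : Set} where

  weight : (A → A → ℕ) → List (A × A) → ℕ
  weight f ps = sum (map (uncurry f) ps)

  weight-++ : ∀ f (ps qs : List (A × A)) → weight f (ps ++ qs) ≡ weight f ps + weight f qs
  weight-++ f ps qs = trans (cong sum (map-++ (uncurry f) ps qs)) (sum-++ (map (uncurry f) ps) _)

  weight-↭ : ∀ f {ps qs : List (A × A)} → ps ↭ qs → weight f ps ≡ weight f qs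
  weight-↭ f ps↭qs = sum-↭ (map⁺ (uncurry f) ps↭qs)

  weight-reversePairs : ∀ f → (∀ x y → f x y ≡ f y x) → (ps : List (A × A)) →
                        weight f (reversePairs ps) ≡ weight f ps
  weight-reversePairs f f-sym ps = begin
    weight f (map swap (reverse ps)) ≡⟨ cong sum (map-swap (reverse ps)) ⟩
    weight f (reverse ps)            ≡⟨ weight-↭ f (↭-reverse ps) ⟩
    weight f ps                      ∎
    where
    open ≡-Reasoning
    map-swap : ∀ qs → map (uncurry f) (map swap qs) ≡ map (uncurry f) qs
    map-swap []             = refl
    map-swap ((x , y) ∷ qs) = cong₂ _∷_ (f-sym y x) (map-swap qs)

  countPairs : (A → A → Bool) → List (A × A) → ℕ
  countPairs f = weight (λ x y → b2n (f x y))

  countPairs-pos : ∀ f ps → 0 < countPairs f ps → ∃[ x ] ∃[ y ] (x , y) ∈ ps × f x y ≡ true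
  countPairs-pos f ps pos with sum-map-pos _ ps pos
  ... | (x , y) , xy∈ , b>0 with f x y in eq
  ...   | true = x , y , xy∈ , eq

  countPairs-zero : ∀ f ps → countPairs f ps ≡ 0 → ∀ {x y} → (x , y) ∈ ps → f x y ≡ false
  countPairs-zero f ps zero-count {x} {y} xy∈ with f x y in eq | ∈⇒≤sum-map (uncurry (λ x y → b2n (f x y))) ps xy∈
  ... | false | _   = refl
  ... | true  | 1≤0 rewrite zero-count with () ← 1≤0

module _ {A : Set} where

  cycPairs-rotate : (xs ys : List A) → cycPairs (xs ++ ys) ↭ cycPairs (ys ++ xs)
  cycPairs-rotate []       ys rewrite ++-identityʳ ys = ↭-refl
  cycPairs-rotate (x ∷ xs) ys = ↭-trans (rotate₁ (xs ++ ys))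
    (subst₂ (λ zs zs′ → cycPairs zs ↭ cycPairs zs′) (sym (++-assoc xs ys [ x ])) (++-assoc ys [ x ] xs)
            (cycPairs-rotate xs (ys ++ [ x ])))
    where
    rotate₁ : (zs : List A) → cycPairs (x ∷ zs) ↭ cycPairs (zs ++ [ x ])
    rotate₁ []       = ↭-refl
    rotate₁ (y ∷ zs) rewrite cycPairs-∷ x (y ∷ zs) | cycPairs-∷ y (zs ++ [ x ])
                           | pathPairs-++ y (zs ++ [ x ]) [ y ] | lastFrom-∷ʳ y zs x =
      ∷↭∷ʳ (x , y) (pathPairs y (zs ++ [ x ]))

  cycPairs-reverse : (a : A) (xs : List A) → cycPairs (a ∷ reverse xs) ≡ reversePairs (cycPairs (a ∷ xs))
  cycPairs-reverse a xs with reverse-pathPairs a (xs ++ [ a ])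
  ... | R , rev , _ , pairs = begin
    cycPairs (a ∷ reverse xs)                          ≡⟨ cycPairs-∷ a (reverse xs) ⟩
    pathPairs a (reverse xs ++ [ a ])                  ≡⟨ cong (pathPairs a) R≡ ⟨
    pathPairs a R                                      ≡⟨ cong (λ z → pathPairs z R) (lastFrom-∷ʳ a xs a) ⟨
    pathPairs (lastFrom a (xs ++ [ a ])) R             ≡⟨ pairs ⟩
    reversePairs (pathPairs a (xs ++ [ a ]))           ≡⟨ cong reversePairs (cycPairs-∷ a xs) ⟨
    reversePairs (cycPairs (a ∷ xs))                   ∎
    where
    open ≡-Reasoning
    R≡ : R ≡ reverse xs ++ [ a ]
    R≡ = proj₂ (∷-injective (trans (sym (trans rev (cong (_∷ R) (lastFrom-∷ʳ a xs a))))
           (trans (unfold-reverse a (xs ++ [ a ])) (cong (_++ [ a ]) (reverse-++ xs [ a ])))))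

  CycleEdge-sym : ∀ {c : List A} {u v} → CycleEdge c u v → CycleEdge c v u
  CycleEdge-sym (inj₁ uv∈) = inj₂ uv∈
  CycleEdge-sym (inj₂ vu∈) = inj₁ vu∈

  CycleEdge-↭ : ∀ {c c′ : List A} → cycPairs c ↭ cycPairs c′ → ∀ {u v} → CycleEdge c u v → CycleEdge c′ u v
  CycleEdge-↭ p (inj₁ uv∈) = inj₁ (∈-resp-↭ p uv∈)
  CycleEdge-↭ p (inj₂ vu∈) = inj₂ (∈-resp-↭ p vu∈)

  CycleEdge-reverse : ∀ (a : A) xs {u v} → CycleEdge (a ∷ xs) u v → CycleEdge (a ∷ reverse xs) u v
  CycleEdge-reverse a xs (inj₁ uv∈) = inj₂ (subst (_ ∈_) (sym (cycPairs-reverse a xs)) (∈-reversePairs⁺ _ uv∈))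
  CycleEdge-reverse a xs (inj₂ vu∈) = inj₁ (subst (_ ∈_) (sym (cycPairs-reverse a xs)) (∈-reversePairs⁺ _ vu∈))

  rotateTo : ∀ {a : A} {c} → a ∈ c → ∃[ r ] c ↭ a ∷ r × cycPairs c ↭ cycPairs (a ∷ r)
  rotateTo {a} a∈ with ∈-∃++ a∈
  ... | xs , ys , refl = ys ++ xs , ++-comm xs (a ∷ ys) , cycPairs-rotate xs (a ∷ ys)

  successorOfHead : ∀ {b : A} (a : A) (r : List A) → Unique (a ∷ r) → (a , b) ∈ cycPairs (a ∷ r) →
                    ∃[ E ] r ++ [ a ] ≡ b ∷ E
  successorOfHead a []      _         (here refl) = [] , refl
  successorOfHead a (h ∷ r) _         (here refl) = r ++ [ a ] , refl
  successorOfHead a (h ∷ r) (a∉ ∷ _) (there ab∈) =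
    ⊥-elim (All.lookup a∉ (proj₁-∈-pathPairs h r a (subst (_ ∈_) (zip-∷-∷ʳ h r a) ab∈)) refl)

  locatePair : ∀ {x y : A} (a : A) (r : List A) → (x , y) ∈ cycPairs (a ∷ r) → ¬ x ≡ a →
               ∃[ L ] ∃[ C ] ∃[ E ] r ≡ L ++ x ∷ C × C ++ [ a ] ≡ y ∷ E
  locatePair {x} {y} a r xy∈ x≢a with split a (r ++ [ a ]) (subst ((x , y) ∈_) (cycPairs-∷ a r) xy∈)
    where
    split : ∀ (z : A) zs → (x , y) ∈ pathPairs z zs → ∃[ L ] ∃[ B ] z ∷ zs ≡ L ++ x ∷ y ∷ B
    split z (z′ ∷ zs) (here refl) = [] , zs , refl
    split z (z′ ∷ zs) (there m) with split z′ zs m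
    ... | L , B , eq = z ∷ L , B , cong (z ∷_) eq
  ... | []    , B , eq = ⊥-elim (x≢a (sym (proj₁ (∷-injective eq))))
  ... | _ ∷ L , B , eq with unsnoc r L (proj₂ (∷-injective eq))
    where
    unsnoc : ∀ xs ys → xs ++ [ a ] ≡ ys ++ x ∷ y ∷ B → ∃[ C ] xs ≡ ys ++ x ∷ C × C ++ [ a ] ≡ y ∷ B
    unsnoc []       []            eq = ⊥-elim (x≢a (sym (proj₁ (∷-injective eq))))
    unsnoc []       (_ ∷ [])      ()
    unsnoc []       (_ ∷ _ ∷ _)   ()
    unsnoc (w ∷ xs) []            eq with ∷-injective eq
    ... | refl , eq′ = xs , refl , eq′
    unsnoc (w ∷ xs) (_ ∷ ys)      eq with ∷-injective eq
    ... | refl , eq′ with unsnoc xs ys eq′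
    ...   | C , eqC , eqC′ = C , cong (w ∷_) eqC , eqC′
  ...   | C , r≡ , C≡ = L , C , B , r≡ , C≡

  weight-proj₁-cycPairs : (f : A → ℕ) (c : List A) → weight (λ x _ → f x) (cycPairs c) ≡ sum (map f c)
  weight-proj₁-cycPairs f []      = refl
  weight-proj₁-cycPairs f (a ∷ r) = trans (cong (weight _) (cycPairs-∷ a r)) (go a r)
    where
    go : ∀ z zs → weight (λ x _ → f x) (pathPairs z (zs ++ [ a ])) ≡ sum (map f (z ∷ zs))
    go z []        = refl
    go z (z′ ∷ zs) = cong (f z +_) (go z′ zs)

  weight-proj₂-cycPairs : (f : A → ℕ) (c : List A) → weight (λ _ y → f y) (cycPairs c) ≡ sum (map f c)
  weight-proj₂-cycPairs f []      = refl
  weight-proj₂-cycPairs f (a ∷ r) = trans (cong (weight _) (cycPairs-∷ a r))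
                                      (trans (go a (r ++ [ a ])) (sum-↭ (map⁺ f (↭-sym (∷↭∷ʳ a r)))))
    where
    go : ∀ z zs → weight (λ _ y → f y) (pathPairs z zs) ≡ sum (map f zs)
    go z []        = refl
    go z (z′ ∷ zs) = cong (f z′ +_) (go z′ zs)

module _ {A : Set} where

  -- The 3-opt exchange: the segments x₁…xₗ and y₁…yₗ trade places and the first is reversed,
  -- so the links a–x₁, xₗ–y₁, yₗ–e of the cycle are replaced by a–y₁, yₗ–xₗ, x₁–e.
  module ThreeOpt (a x₁ : A) (X : List A) (y₁ : A) (Y C : List A) (e : A) (E : List A)
                  (C∷ʳa : C ++ [ a ] ≡ e ∷ E) where

    xₗ yₗ : A
    xₗ = lastFrom x₁ X
    yₗ = lastFrom y₁ Y

    before after : List A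
    before = a ∷ (x₁ ∷ X) ++ (y₁ ∷ Y) ++ C
    after  = a ∷ (y₁ ∷ Y) ++ reverse (x₁ ∷ X) ++ C

    private
      close : (P Q : List A) → (P ++ Q ++ C) ++ [ a ] ≡ P ++ Q ++ e ∷ E
      close P Q = trans (++-assoc P _ [ a ]) (cong (P ++_) (trans (++-assoc Q C [ a ]) (cong (Q ++_) C∷ʳa)))

    cycPairs-before : cycPairs before ≡
      (a , x₁) ∷ pathPairs x₁ X ++ (xₗ , y₁) ∷ pathPairs y₁ Y ++ (yₗ , e) ∷ pathPairs e E
    cycPairs-before = begin
      cycPairs before                                     ≡⟨ cycPairs-∷ a ((x₁ ∷ X) ++ (y₁ ∷ Y) ++ C) ⟩
      pathPairs a (((x₁ ∷ X) ++ (y₁ ∷ Y) ++ C) ++ [ a ]) ≡⟨ cong (pathPairs a) (close (x₁ ∷ X) (y₁ ∷ Y)) ⟩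
      (a , x₁) ∷ pathPairs x₁ (X ++ y₁ ∷ Y ++ e ∷ E)    ≡⟨ cong ((a , x₁) ∷_) (pathPairs-++ x₁ X _) ⟩
      (a , x₁) ∷ pathPairs x₁ X ++ (xₗ , y₁) ∷ pathPairs y₁ (Y ++ e ∷ E)
        ≡⟨ cong (λ ps → (a , x₁) ∷ pathPairs x₁ X ++ (xₗ , y₁) ∷ ps) (pathPairs-++ y₁ Y _) ⟩
      (a , x₁) ∷ pathPairs x₁ X ++ (xₗ , y₁) ∷ pathPairs y₁ Y ++ (yₗ , e) ∷ pathPairs e E ∎
      where open ≡-Reasoning

    cycPairs-after : cycPairs after ≡
      (a , y₁) ∷ pathPairs y₁ Y ++ (yₗ , xₗ) ∷ reversePairs (pathPairs x₁ X) ++ (x₁ , e) ∷ pathPairs e E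
    cycPairs-after with reverse-pathPairs x₁ X
    ... | R , rev , last , pairs = begin
      cycPairs after                                           ≡⟨ cycPairs-∷ a ((y₁ ∷ Y) ++ reverse (x₁ ∷ X) ++ C) ⟩
      pathPairs a (((y₁ ∷ Y) ++ reverse (x₁ ∷ X) ++ C) ++ [ a ]) ≡⟨ cong (λ Z → pathPairs a (((y₁ ∷ Y) ++ Z ++ C) ++ [ a ])) rev ⟩
      pathPairs a (((y₁ ∷ Y) ++ (xₗ ∷ R) ++ C) ++ [ a ])      ≡⟨ cong (pathPairs a) (close (y₁ ∷ Y) (xₗ ∷ R)) ⟩
      (a , y₁) ∷ pathPairs y₁ (Y ++ xₗ ∷ R ++ e ∷ E)
        ≡⟨ cong ((a , y₁) ∷_) (pathPairs-++ y₁ Y _) ⟩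
      (a , y₁) ∷ pathPairs y₁ Y ++ (yₗ , xₗ) ∷ pathPairs xₗ (R ++ e ∷ E)
        ≡⟨ cong (λ ps → (a , y₁) ∷ pathPairs y₁ Y ++ (yₗ , xₗ) ∷ ps) (pathPairs-++ xₗ R _) ⟩
      (a , y₁) ∷ pathPairs y₁ Y ++ (yₗ , xₗ) ∷ pathPairs xₗ R ++ (lastFrom xₗ R , e) ∷ pathPairs e E
        ≡⟨ cong₂ (λ ps z → (a , y₁) ∷ pathPairs y₁ Y ++ (yₗ , xₗ) ∷ ps ++ (z , e) ∷ pathPairs e E) pairs last ⟩
      (a , y₁) ∷ pathPairs y₁ Y ++ (yₗ , xₗ) ∷ reversePairs (pathPairs x₁ X) ++ (x₁ , e) ∷ pathPairs e E ∎
      where open ≡-Reasoning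

    before↭after : before ↭ after
    before↭after = prep a (↭-trans (↭-sym (++-assoc-↭ (x₁ ∷ X) (y₁ ∷ Y) C))
                   (↭-trans (++⁺ʳ C (++-comm (x₁ ∷ X) (y₁ ∷ Y)))
                   (↭-trans (++-assoc-↭ (y₁ ∷ Y) (x₁ ∷ X) C)
                            (++⁺ˡ (y₁ ∷ Y) (++⁺ʳ C (↭-sym (↭-reverse (x₁ ∷ X))))))))
      where
      ++-assoc-↭ : (P Q R : List A) → (P ++ Q) ++ R ↭ P ++ Q ++ R
      ++-assoc-↭ P Q R rewrite ++-assoc P Q R = ↭-refl

    weight-exchange : ∀ f → (∀ x y → f x y ≡ f y x) →
      weight f (cycPairs after) + (f a x₁ + f xₗ y₁ + f yₗ e) ≡ weight f (cycPairs before) + (f a y₁ + f yₗ xₗ + f x₁ e)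
    weight-exchange f f-sym = begin
      weight f (cycPairs after) + (f a x₁ + f xₗ y₁ + f yₗ e)
        ≡⟨ cong (_+ (f a x₁ + f xₗ y₁ + f yₗ e)) weight-after ⟩
      f a y₁ + (wY + (f yₗ xₗ + (wX + (f x₁ e + wE)))) + (f a x₁ + f xₗ y₁ + f yₗ e)
        ≡⟨ solve 9 (λ p q r u v w kx ky ke → u :+ (ky :+ (v :+ (kx :+ (w :+ ke)))) :+ (p :+ q :+ r)
                                          := p :+ (kx :+ (q :+ (ky :+ (r :+ ke)))) :+ (u :+ v :+ w))
             refl (f a x₁) (f xₗ y₁) (f yₗ e) (f a y₁) (f yₗ xₗ) (f x₁ e) wX wY wE ⟩
      f a x₁ + (wX + (f xₗ y₁ + (wY + (f yₗ e + wE)))) + (f a y₁ + f yₗ xₗ + f x₁ e)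
        ≡⟨ cong (_+ (f a y₁ + f yₗ xₗ + f x₁ e)) weight-before ⟨
      weight f (cycPairs before) + (f a y₁ + f yₗ xₗ + f x₁ e) ∎
      where
      open ≡-Reasoning
      open +-*-Solver
      wX = weight f (pathPairs x₁ X)
      wY = weight f (pathPairs y₁ Y)
      wE = weight f (pathPairs e E)
      weight-links : ∀ p P q Q r R → weight f (p ∷ P ++ q ∷ Q ++ r ∷ R) ≡
        uncurry f p + (weight f P + (uncurry f q + (weight f Q + (uncurry f r + weight f R))))
      weight-links p P q Q r R = cong (uncurry f p +_)
        (trans (weight-++ f P _) (cong (λ w → weight f P + (uncurry f q + w)) (weight-++ f Q _)))
      weight-before : weight f (cycPairs before) ≡ f a x₁ + (wX + (f xₗ y₁ + (wY + (f yₗ e + wE))))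
      weight-before = trans (cong (weight f) cycPairs-before)
        (weight-links (a , x₁) (pathPairs x₁ X) (xₗ , y₁) (pathPairs y₁ Y) (yₗ , e) (pathPairs e E))
      weight-after : weight f (cycPairs after) ≡ f a y₁ + (wY + (f yₗ xₗ + (wX + (f x₁ e + wE))))
      weight-after = trans (cong (weight f) cycPairs-after)
        (trans (weight-links (a , y₁) (pathPairs y₁ Y) (yₗ , xₗ) (reversePairs (pathPairs x₁ X)) (x₁ , e) (pathPairs e E))
               (cong (λ w → f a y₁ + (wY + (f yₗ xₗ + (w + (f x₁ e + wE))))) (weight-reversePairs f f-sym (pathPairs x₁ X))))

    weight-after+≤ : ∀ f → (∀ x y → f x y ≡ f y x) → f a y₁ ≡ 0 → f x₁ e ≡ 0 → f yₗ xₗ ≤ f xₗ y₁ →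
                     weight f (cycPairs after) + f a x₁ ≤ weight f (cycPairs before)
    weight-after+≤ f f-sym ay₁ x₁e yx≤xy = +-cancelʳ-≤ (f xₗ y₁) _ _ (begin
      weight f (cycPairs after) + f a x₁ + f xₗ y₁         ≤⟨ +-monoʳ-≤ _ (m≤m+n (f xₗ y₁) (f yₗ e)) ⟩
      weight f (cycPairs after) + f a x₁ + (f xₗ y₁ + f yₗ e)
        ≡⟨ trans (+-assoc (weight f (cycPairs after)) (f a x₁) _) (cong (weight f (cycPairs after) +_) (sym (+-assoc (f a x₁) (f xₗ y₁) (f yₗ e)))) ⟩
      weight f (cycPairs after) + (f a x₁ + f xₗ y₁ + f yₗ e) ≡⟨ weight-exchange f f-sym ⟩
      weight f (cycPairs before) + (f a y₁ + f yₗ xₗ + f x₁ e) ≡⟨ cong₂ (λ p q → weight f (cycPairs before) + (p + f yₗ xₗ + q)) ay₁ x₁e ⟩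
      weight f (cycPairs before) + (f yₗ xₗ + 0)             ≤⟨ +-monoʳ-≤ _ (≤-trans (≤-reflexive (+-identityʳ _)) yx≤xy) ⟩
      weight f (cycPairs before) + f xₗ y₁                   ∎)
      where open ≤-Reasoning

    private
      ∈-after : ∀ {p} → p ∈ (a , y₁) ∷ pathPairs y₁ Y ++ (yₗ , xₗ) ∷ reversePairs (pathPairs x₁ X) ++ (x₁ , e) ∷ pathPairs e E →
                p ∈ cycPairs after
      ∈-after {p} = subst (p ∈_) (sym cycPairs-after)

    ∈-cycPairs-before : ∀ {u v} → (u , v) ∈ cycPairs before →
      (u , v) ≡ (a , x₁) ⊎ (u , v) ≡ (xₗ , y₁) ⊎ (u , v) ≡ (yₗ , e) ⊎ CycleEdge after u v
    ∈-cycPairs-before m rewrite cycPairs-before with m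
    ... | here eq = inj₁ eq
    ... | there m′ with ∈-++⁻ (pathPairs x₁ X) m′
    ...   | inj₁ inX = inj₂ (inj₂ (inj₂ (inj₂ (∈-after (there (∈-++⁺ʳ (pathPairs y₁ Y) (there (∈-++⁺ˡ (∈-reversePairs⁺ (pathPairs x₁ X) inX)))))))))
    ...   | inj₂ (here eq) = inj₂ (inj₁ eq)
    ...   | inj₂ (there m″) with ∈-++⁻ (pathPairs y₁ Y) m″
    ...     | inj₁ inY = inj₂ (inj₂ (inj₂ (inj₁ (∈-after (there (∈-++⁺ˡ inY))))))
    ...     | inj₂ (here eq) = inj₂ (inj₂ (inj₁ eq))
    ...     | inj₂ (there inE) = inj₂ (inj₂ (inj₂ (inj₁ (∈-after (there (∈-++⁺ʳ (pathPairs y₁ Y) (there (∈-++⁺ʳ (reversePairs (pathPairs x₁ X)) (there inE)))))))))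

    a-y₁-after : CycleEdge after a y₁
    a-y₁-after = inj₁ (∈-after (here refl))

    yₗ-xₗ-after : CycleEdge after yₗ xₗ
    yₗ-xₗ-after = inj₁ (∈-after (there (∈-++⁺ʳ (pathPairs y₁ Y) (here refl))))

module _ {n : ℕ} (G : Graph n) where

  deg≤n : ∀ v → deg G v ≤ n
  deg≤n v = subst (deg G v ≤_) (length-tabulate (λ x → x)) (count≤length (adj G v) (allFin n))

  adj⇒deg>0 : ∀ v u → adj G v u ≡ true → 0 < deg G v
  adj⇒deg>0 v u vu = subst (λ b → b2n b ≤ deg G v) vu (∈⇒≤sum-map (λ x → b2n (adj G v x)) (allFin n) (∈-allFin u))

  3≤deg : ∀ v {p q r} → ¬ p ≡ q → ¬ p ≡ r → ¬ q ≡ r →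
          adj G v p ≡ true → adj G v q ≡ true → adj G v r ≡ true → 3 ≤ deg G v
  3≤deg v {p} {q} {r} p≢q p≢r q≢r vp vq vr = begin
    1 + 1 + 1                                           ≤⟨ +-mono-≤ (+-mono-≤ (one p) (one q)) (one r) ⟩
    count (_≟ᵇ p) all + count (_≟ᵇ q) all + count (_≟ᵇ r) all
      ≡⟨ cong (_+ count (_≟ᵇ r) all) (sum-map-+ (λ x → b2n (x ≟ᵇ p)) (λ x → b2n (x ≟ᵇ q)) all) ⟨
    sum (map (λ x → b2n (x ≟ᵇ p) + b2n (x ≟ᵇ q)) all) + count (_≟ᵇ r) all
      ≡⟨ sum-map-+ (λ x → b2n (x ≟ᵇ p) + b2n (x ≟ᵇ q)) (λ x → b2n (x ≟ᵇ r)) all ⟨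
    sum (map (λ x → b2n (x ≟ᵇ p) + b2n (x ≟ᵇ q) + b2n (x ≟ᵇ r)) all) ≤⟨ sum-map-mono _ _ pointwise all ⟩
    deg G v                                             ∎
    where
    open ≤-Reasoning
    all = allFin n
    _≟ᵇ_ : Fin n → Fin n → Bool
    x ≟ᵇ y = does (x ≟ y)
    one : ∀ z → 1 ≤ count (_≟ᵇ z) all
    one z with z ≟ z | ∈⇒≤sum-map (λ x → b2n (x ≟ᵇ z)) all (∈-allFin z)
    ... | yes _ | 1≤ = 1≤
    ... | no z≢z | _ = ⊥-elim (z≢z refl)
    pointwise : ∀ x → b2n (x ≟ᵇ p) + b2n (x ≟ᵇ q) + b2n (x ≟ᵇ r) ≤ b2n (adj G v x)
    pointwise x with x ≟ p | x ≟ q | x ≟ r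
    ... | yes refl | yes refl | _        = ⊥-elim (p≢q refl)
    ... | yes refl | _        | yes refl = ⊥-elim (p≢r refl)
    ... | _        | yes refl | yes refl = ⊥-elim (q≢r refl)
    ... | yes refl | no _     | no _     = ≤-reflexive (cong b2n (sym vp))
    ... | no _     | yes refl | no _     = ≤-reflexive (cong b2n (sym vq))
    ... | no _     | no _     | yes refl = ≤-reflexive (cong b2n (sym vr))
    ... | no _     | no _     | no _     = z≤n

  handshake : sum (map (deg G) (allFin n)) ≡ 2 * numEdges G
  handshake = begin
    sum (map (deg G) all)
      ≡⟨ sum-map-cong (λ u → trans (sum-map-cong (split u) all) (sum-map-+ _ _ all)) all ⟩
    sum (map (λ u → sum (map (edge u) all) + sum (map (λ v → edge v u) all)) all)
      ≡⟨ sum-map-+ _ _ all ⟩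
    numEdges G + sum (map (λ u → sum (map (λ v → edge v u) all)) all)
      ≡⟨ cong (numEdges G +_) (sum-map-swap edge all all) ⟨
    numEdges G + numEdges G
      ≡⟨ cong (numEdges G +_) (+-identityʳ _) ⟨
    2 * numEdges G ∎
    where
    open ≡-Reasoning
    all = allFin n
    edge : Fin n → Fin n → ℕ
    edge u v = b2n ((toℕ u <ᵇ toℕ v) ∧ adj G u v)
    ≮ : ∀ {a b : Fin n} → (toℕ a <ᵇ toℕ b) ≡ false → ¬ toℕ a < toℕ b
    ≮ eq lt = subst T eq (<⇒<ᵇ lt)
    split : ∀ u v → b2n (adj G u v) ≡ edge u v + edge v u
    split u v with toℕ u <ᵇ toℕ v in uv | toℕ v <ᵇ toℕ u in vu
    ... | true  | true  = ⊥-elim (<-asym (<ᵇ⇒< (toℕ u) (toℕ v) (subst T (sym uv) tt)) (<ᵇ⇒< (toℕ v) (toℕ u) (subst T (sym vu) tt)))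
    ... | true  | false = sym (+-identityʳ _)
    ... | false | true  = cong b2n (Graph.sym G u v)
    ... | false | false with refl ← toℕ-injective {i = u} {j = v} (≤-antisym (≮⇒≥ (≮ {v} {u} vu)) (≮⇒≥ (≮ {u} {v} uv))) =
      cong b2n (Graph.irrefl G u)

descent : {X : Set} (μ : X → ℕ) (P : X → Set) →
          (∀ x → P x → 0 < μ x → ∃[ y ] P y × μ y < μ x) →
          ∀ x → P x → ∃[ y ] P y × μ y ≡ 0
descent μ P step x px = go x px (μ x) ≤-refl
  where
  go : ∀ x → P x → ∀ m → μ x ≤ m → ∃[ y ] P y × μ y ≡ 0
  go x px m μx≤m with μ x in eq
  ... | zero = x , px , eq
  ... | suc w with m | step x px (subst (0 <_) (sym eq) z<s)
  ...   | suc m | y , py , μy<μx = go y py m (≤-trans (≤-pred (subst (μ y <_) eq μy<μx)) (≤-pred μx≤m))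

Covers : ∀ {n} → Graph n → List (Fin n) → Set
Covers S c = ∀ u v → adj S u v ≡ true → CycleEdge c u v

record Tour (n : ℕ) : Set where
  constructor tour
  field
    order    : List (Fin n)
    unique   : Unique order
    complete : ∀ v → v ∈ order
open Tour public

module _ {n : ℕ} where

  links : Tour n → List (Fin n × Fin n)
  links t = cycPairs (order t)

  order↭allFin : (t : Tour n) → order t ↭ allFin n
  order↭allFin t = ∼bag⇒↭ (unique∧set⇒bag (unique t) (allFin⁺ n) (mk⇔ (λ _ → ∈-allFin _) (λ _ → complete t _)))

  reorder : (t : Tour n) (c : List (Fin n)) → order t ↭ c → Tour n
  reorder t c p = tour c (Unique-resp-↭ p (unique t)) (λ v → ∈-resp-↭ p (complete t v))

  length-order : (t : Tour n) → length (order t) ≡ n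
  length-order t = trans (↭-length (order↭allFin t)) (length-tabulate (λ x → x))

  sum-order : (t : Tour n) (f : Fin n → ℕ) → sum (map f (order t)) ≡ sum (map f (allFin n))
  sum-order t f = sum-↭ (map⁺ f (order↭allFin t))

  weight-links-proj₁ : (t : Tour n) (f : Fin n → ℕ) → weight (λ x _ → f x) (links t) ≡ sum (map f (allFin n))
  weight-links-proj₁ t f = trans (weight-proj₁-cycPairs f (order t)) (sum-order t f)

  weight-links-proj₂ : (t : Tour n) (f : Fin n → ℕ) → weight (λ _ y → f y) (links t) ≡ sum (map f (allFin n))
  weight-links-proj₂ t f = trans (weight-proj₂-cycPairs f (order t)) (sum-order t f)

-- Covering a linear forest

module LinearForestCover {n : ℕ} (S : Graph n) (S-linear : IsLinearForest S) (3≤n : 3 ≤ n) where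

  private
    S-loop : ∀ {x y} → x ≡ y → adj S x y ≡ true → ⊥
    S-loop {x} refl xy with () ← trans (sym (Graph.irrefl S x)) xy

    maxDeg2 : ∀ v {p q r} → ¬ p ≡ q → ¬ p ≡ r → ¬ q ≡ r →
              adj S v p ≡ true → adj S v q ≡ true → adj S v r ≡ true → ⊥
    maxDeg2 v p≢q p≢r q≢r vp vq vr = <-irrefl refl (≤-<-trans (3≤deg S v p≢q p≢r q≢r vp vq vr) (s≤s (proj₁ S-linear v)))

  -- abstract, so that `with CycleEdge? c u v` also abstracts its occurrences inside #uncovered c
  abstract
    CycleEdge? : (c : List (Fin n)) (u v : Fin n) → Dec (CycleEdge c u v)
    CycleEdge? c u v = _∈?_ (≡-dec _≟_ _≟_) (u , v) (cycPairs c) ⊎-dec _∈?_ (≡-dec _≟_ _≟_) (v , u) (cycPairs c)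

  uncovered : List (Fin n) → Fin n → Fin n → ℕ
  uncovered c u v = b2n (adj S u v ∧ not (does (CycleEdge? c u v)))

  #uncovered : List (Fin n) → ℕ
  #uncovered c = sum (map (λ u → sum (map (uncovered c u) (allFin n))) (allFin n))

  #uncovered≡0⇒Covers : ∀ c → #uncovered c ≡ 0 → Covers S c
  #uncovered≡0⇒Covers c none u v uv
    with CycleEdge? c u v | ∈⇒≤sum-map (uncovered c u) (allFin n) (∈-allFin v)
       | ∈⇒≤sum-map (λ u → sum (map (uncovered c u) (allFin n))) (allFin n) (∈-allFin u)
  ... | yes uv∈c | _ | _ = uv∈c
  ... | no _ | ≤row | ≤total rewrite uv with () ← ≤-trans ≤row (≤-trans ≤total (≤-reflexive none))

  #uncovered>0 : ∀ c → 0 < #uncovered c → ∃[ u ] ∃[ v ] adj S u v ≡ true × ¬ CycleEdge c u v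
  #uncovered>0 c pos with sum-map-pos _ (allFin n) pos
  ... | u , _ , pos′ with sum-map-pos _ (allFin n) pos′
  ...   | v , _ , _ with adj S u v in uv | CycleEdge? c u v
  ...     | true | no uv∉c = u , v , uv , uv∉c

  #uncovered-< : ∀ c c′ → (∀ u v → adj S u v ≡ true → CycleEdge c u v → CycleEdge c′ u v) →
                 ∀ u v → adj S u v ≡ true → ¬ CycleEdge c u v → CycleEdge c′ u v → #uncovered c′ < #uncovered c
  #uncovered-< c c′ keeps u₀ v₀ uv₀ uv₀∉c uv₀∈c′ =
    sum-map-mono-< _ _ (λ u → sum-map-mono _ _ (pointwise u) (allFin n)) (allFin n) (∈-allFin u₀)
                   (sum-map-mono-< _ _ (pointwise u₀) (allFin n) (∈-allFin v₀) strict)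
    where
    pointwise : ∀ u v → uncovered c′ u v ≤ uncovered c u v
    pointwise u v with adj S u v in uv | CycleEdge? c u v | CycleEdge? c′ u v
    ... | false | _          | _           = z≤n
    ... | true  | no _       | _           = b2n≤1 _
    ... | true  | yes _      | yes _       = ≤-refl
    ... | true  | yes uv∈c   | no uv∉c′    = ⊥-elim (uv∉c′ (keeps u v uv uv∈c))
    strict : uncovered c′ u₀ v₀ < uncovered c u₀ v₀
    strict with adj S u₀ v₀ | CycleEdge? c u₀ v₀ | CycleEdge? c′ u₀ v₀
    ... | true | yes uv∈c | _          = ⊥-elim (uv₀∉c uv∈c)
    ... | true | no _     | yes _      = z<s
    ... | true | no _     | no uv∉c′   = ⊥-elim (uv∉c′ uv₀∈c′)

  record Opening (t : Tour n) (u v : Fin n) : Set where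
    field
      h      : Fin n
      rest   : List (Fin n)
      uh∉S   : adj S u h ≡ false
      ↭order : order t ↭ u ∷ h ∷ rest
      keeps  : ∀ p q → CycleEdge (order t) p q → CycleEdge (u ∷ h ∷ rest) p q
      uv∉    : ¬ CycleEdge (u ∷ h ∷ rest) u v

  -- u has at most two S-neighbours and v is one of them, so one of the two tour-neighbours
  -- of u is not; reversing the tour if necessary, it is the successor h.
  opening : (t : Tour n) (u v : Fin n) → adj S u v ≡ true → ¬ CycleEdge (order t) u v → Opening t u v
  opening t u v uv uv∉t with rotateTo (complete t u)
  ... | r , t↭ , links↭ = go r t↭ links↭ (trans (sym (↭-length t↭)) (length-order t))
    where
    back : ∀ r → cycPairs (order t) ↭ cycPairs (u ∷ r) → ¬ CycleEdge (u ∷ r) u v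
    back r links↭ uv∈ = uv∉t (CycleEdge-↭ {c = u ∷ r} {c′ = order t} (↭-sym links↭) uv∈)
    go : (r : List (Fin n)) → order t ↭ u ∷ r → cycPairs (order t) ↭ cycPairs (u ∷ r) → length (u ∷ r) ≡ n → Opening t u v
    go []            _ _ len = ⊥-elim (<-irrefl len (≤-trans (s≤s (s≤s z≤n)) 3≤n))
    go (_ ∷ [])      _ _ len = ⊥-elim (<-irrefl len (≤-trans (s≤s (s≤s (s≤s z≤n))) 3≤n))
    go (h ∷ h₂ ∷ r₂) t↭ links↭ _ with adj S u h in uh
    ... | false = record { h = h ; rest = h₂ ∷ r₂ ; uh∉S = uh ; ↭order = t↭
                         ; keeps = λ _ _ → CycleEdge-↭ {c = order t} {c′ = u ∷ h ∷ h₂ ∷ r₂} links↭ ; uv∉ = back (h ∷ h₂ ∷ r₂) links↭ }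
    ... | true = record
      { h = z ; rest = R ; uh∉S = uz∉S
      ; ↭order = ↭-trans t↭ (subst (λ w → u ∷ hr ↭ u ∷ w) rev (prep u (↭-sym (↭-reverse hr))))
      ; keeps = λ p q pq → subst (λ w → CycleEdge (u ∷ w) p q) rev (CycleEdge-reverse u hr (CycleEdge-↭ {c = order t} {c′ = u ∷ hr} links↭ pq))
      ; uv∉ = λ uv∈ → back hr links↭ (subst (λ w → CycleEdge (u ∷ w) u v) (reverse-involutive hr)
                        (CycleEdge-reverse u (reverse hr) (subst (λ w → CycleEdge (u ∷ w) u v) (sym rev) uv∈)))
      }
      where
      hr : List (Fin n)
      hr = h ∷ h₂ ∷ r₂
      z : Fin n
      z = lastFrom h₂ r₂
      R : List (Fin n)
      R = proj₁ (reverse-pathPairs h (h₂ ∷ r₂))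
      rev : reverse hr ≡ z ∷ R
      rev = proj₁ (proj₂ (reverse-pathPairs h (h₂ ∷ r₂)))
      h≢z : ¬ h ≡ z
      h≢z = Unique-∷⇒≢ (Unique-tail (Unique-resp-↭ t↭ (unique t))) (lastFrom-∈ h₂ r₂)
      h≢v : ¬ h ≡ v
      h≢v refl = back hr links↭ (inj₁ (here refl))
      z≢v : ¬ z ≡ v
      z≢v refl = back hr links↭ (inj₂ (subst ((z , u) ∈_) (sym (cycPairs-∷ u hr)) (lastFrom-pathPairs u hr u)))
      uz∉S : adj S u z ≡ false
      uz∉S with adj S u z in uz
      ... | false = refl
      ... | true = ⊥-elim (maxDeg2 u h≢z h≢v z≢v uh uz uv)

  record SRun (x : Fin n) (M : List (Fin n)) : Set where
    field
      run stop : List (Fin n)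
      split    : M ≡ run ++ stop
      along    : ∀ p q → (p , q) ∈ pathPairs x run → adj S p q ≡ true
      stopped  : stop ≡ [] ⊎ ∃[ c ] ∃[ C ] stop ≡ c ∷ C × adj S (lastFrom x run) c ≡ false

  followS : (x : Fin n) (M : List (Fin n)) → SRun x M
  followS x [] = record { run = [] ; stop = [] ; split = refl ; along = λ _ _ () ; stopped = inj₁ refl }
  followS x (y ∷ M) with adj S x y in xy
  ... | false = record { run = [] ; stop = y ∷ M ; split = refl ; along = λ _ _ () ; stopped = inj₂ (y , M , refl , xy) }
  ... | true = record { run = y ∷ SRun.run w ; stop = SRun.stop w ; split = cong (y ∷_) (SRun.split w)
                      ; along = along ; stopped = SRun.stopped w }
    where
    w = followS y M
    along : ∀ p q → (p , q) ∈ pathPairs x (y ∷ SRun.run w) → adj S p q ≡ true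
    along p q (here refl) = xy
    along p q (there pq∈) = SRun.along w p q pq∈

  S-path-not-closed : ∀ u v r R → Unique (u ∷ v ∷ r ∷ R) → adj S u v ≡ true →
                      (∀ p q → (p , q) ∈ pathPairs v (r ∷ R) → adj S p q ≡ true) → adj S (lastFrom r R) u ≡ false
  S-path-not-closed u v r R uniq uv along with adj S (lastFrom r R) u in closing
  ... | false = refl
  ... | true = ⊥-elim (proj₂ S-linear (u ∷ v ∷ r ∷ R) (s≤s (s≤s (s≤s z≤n)) , uniq , inS))
    where
    inS : ∀ p q → (p , q) ∈ cycPairs (u ∷ v ∷ r ∷ R) → adj S p q ≡ true
    inS p q (here refl) = uv
    inS p q (there pq∈) with ∈-++⁻ (pathPairs v (r ∷ R))
      (subst ((p , q) ∈_) (trans (zip-∷-∷ʳ v (r ∷ R) u) (pathPairs-++ v (r ∷ R) [ u ])) pq∈)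
    ... | inj₁ pq∈run     = along p q pq∈run
    ... | inj₂ (here refl) = closing

  private
    Improvement : Tour n → Set
    Improvement t = ∃[ t′ ] #uncovered (order t′) < #uncovered (order t)

  -- If xₗ–v is an S-edge then v already has the S-neighbours u and xₗ, so the S-run from v is empty.
  S-run-empty : ∀ u v h L R C → Unique (u ∷ h ∷ L ++ v ∷ R ++ C) → adj S u v ≡ true →
                (∀ p q → (p , q) ∈ pathPairs v R → adj S p q ≡ true) → adj S (lastFrom h L) v ≡ true → R ≡ []
  S-run-empty u v h L []      C uniq uv along xv = refl
  S-run-empty u v h L (r ∷ R) C uniq uv along xv =
    ⊥-elim (maxDeg2 v u≢r u≢x (λ eq → x≢r (sym eq)) (trans (Graph.sym S v u) uv) (along v r (here refl)) (trans (Graph.sym S v x) xv))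
    where
    x = lastFrom h L
    u≢x : ¬ u ≡ x
    u≢x = Unique-∷⇒≢ uniq (∈-++⁺ˡ (lastFrom-∈ h L))
    u≢r : ¬ u ≡ r
    u≢r = Unique-∷⇒≢ uniq (∈-++⁺ʳ (h ∷ L) (there (here refl)))
    x≢r : ¬ x ≡ r
    x≢r = Unique-++⇒≢ (h ∷ L) (Unique-tail uniq) (lastFrom-∈ h L) (there (here refl))

  -- The exchange u h…xₗ v…yₗ e… ↦ u v…yₗ xₗ…h e… creates the link u–v and breaks only
  -- u–h, xₗ–v and yₗ–e; the first and last are not S-edges and the middle one survives as yₗ–xₗ.
  cover-by-exchange : (t : Tour n) (u v h : Fin n) (L R C : List (Fin n)) (e : Fin n) (E : List (Fin n)) →
    C ++ [ u ] ≡ e ∷ E → adj S u v ≡ true → ¬ CycleEdge (order t) u v → adj S u h ≡ false →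
    order t ↭ u ∷ h ∷ L ++ v ∷ R ++ C →
    (∀ p q → CycleEdge (order t) p q → CycleEdge (u ∷ h ∷ L ++ v ∷ R ++ C) p q) →
    (∀ p q → (p , q) ∈ pathPairs v R → adj S p q ≡ true) → adj S (lastFrom v R) e ≡ false → Improvement t
  cover-by-exchange t u v h L R C e E C∷ʳu uv uv∉t uh∉S t↭ keeps along ye∉S =
    reorder t after (↭-trans t↭ before↭after) , #uncovered-< (order t) after kept u v uv uv∉t a-y₁-after
    where
    open ThreeOpt u h L v R C e E C∷ʳu
    xv-kept : adj S xₗ v ≡ true → CycleEdge after xₗ v
    xv-kept xv = CycleEdge-sym {c = after} (subst (λ w → CycleEdge after w xₗ)
                   (cong (lastFrom v) (S-run-empty u v h L R C (Unique-resp-↭ t↭ (unique t)) uv along xv)) yₗ-xₗ-after)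
    kept′ : ∀ p q → adj S p q ≡ true → (p , q) ∈ cycPairs before → CycleEdge after p q
    kept′ p q pq pq∈ with ∈-cycPairs-before pq∈
    ... | inj₁ refl                      with () ← trans (sym uh∉S) pq
    ... | inj₂ (inj₁ refl)               = xv-kept pq
    ... | inj₂ (inj₂ (inj₁ refl))        with () ← trans (sym ye∉S) pq
    ... | inj₂ (inj₂ (inj₂ pq∈after))    = pq∈after
    kept : ∀ p q → adj S p q ≡ true → CycleEdge (order t) p q → CycleEdge after p q
    kept p q pq pq∈t with keeps p q pq∈t
    ... | inj₁ pq∈ = kept′ p q pq pq∈
    ... | inj₂ qp∈ = CycleEdge-sym {c = after} (kept′ q p (trans (Graph.sym S q p) pq) qp∈)

  cover-one : (t : Tour n) → 0 < #uncovered (order t) → Improvement t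
  cover-one t pos with #uncovered>0 (order t) pos
  ... | u , v , uv , uv∉t with opening t u v uv uv∉t
  ...   | record { h = h ; rest = rest ; uh∉S = uh∉S ; ↭order = t↭ ; keeps = keeps ; uv∉ = uv∉ }
          with ∈-resp-↭ t↭ (complete t v)
  ...     | here v≡u = ⊥-elim (S-loop (sym v≡u) uv)
  ...     | there v∈ with ∈-∃++ v∈
  ...       | []    , M , h∷rest≡ = ⊥-elim (uv∉ (inj₁ (here (cong (u ,_) (sym (proj₁ (∷-injective h∷rest≡)))))))
  ...       | _ ∷ L , M , h∷rest≡ with refl , refl ← ∷-injective h∷rest≡ with followS v M
  ...         | record { run = R ; split = refl ; along = along ; stopped = inj₂ (c , C , refl , yc∉S) } =
                  cover-by-exchange t u v h L R (c ∷ C) c (C ++ [ u ]) refl uv uv∉t uh∉S t↭ keeps along yc∉S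
  ...         | record { run = R ; split = refl ; along = along ; stopped = inj₁ refl } =
                  cover-by-exchange t u v h L R [] u [] refl uv uv∉t uh∉S t↭ keeps along
                    (closing R uv∉ (Unique-resp-↭ t↭ (unique t)) along)
    where
    closing : ∀ R → ¬ CycleEdge (u ∷ h ∷ L ++ v ∷ R ++ []) u v → Unique (u ∷ h ∷ L ++ v ∷ R ++ []) →
              (∀ p q → (p , q) ∈ pathPairs v R → adj S p q ≡ true) → adj S (lastFrom v R) u ≡ false
    closing [] uv∉ _ _ with adj S v u in vu
    ... | false = refl
    ... | true = ⊥-elim (uv∉ (inj₂ (subst ((v , u) ∈_) (sym (cycPairs-∷ u (h ∷ L ++ [ v ])))
                   (subst (λ w → (w , u) ∈ pathPairs u ((h ∷ L ++ [ v ]) ++ [ u ])) (lastFrom-∷ʳ h L v)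
                          (lastFrom-pathPairs u (h ∷ L ++ [ v ]) u)))))
    closing (r ∷ R) _ uniq along = S-path-not-closed u v r R
      (subst (λ w → Unique (u ∷ v ∷ w)) (++-identityʳ (r ∷ R)) (Unique-∷-++⁻ʳ (h ∷ L) uniq)) uv along

  coveringTour : ∃[ t ] Covers S (order t)
  coveringTour with descent (λ t → #uncovered (order t)) (λ _ → ⊤) (λ t _ pos → map₂ (tt ,_) (cover-one t pos))
                            (tour (allFin n) (allFin⁺ n) ∈-allFin) tt
  ... | t , _ , none = t , #uncovered≡0⇒Covers (order t) none

-- Exchanges along a tour

module Exchange {n : ℕ} (G S : Graph n) where

  bad : Fin n → Fin n → Bool
  bad u v = not (adj (G ⊕ S) u v)

  bad-sym : ∀ u v → bad u v ≡ bad v u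
  bad-sym u v = cong not (Graph.sym (G ⊕ S) u v)

  adjG⇒¬bad : ∀ {u v} → adj G u v ≡ true → bad u v ≡ false
  adjG⇒¬bad uv rewrite uv = refl

  bad⇒¬adjG : ∀ {u v} → bad u v ≡ true → adj G u v ≡ false
  bad⇒¬adjG {u} {v} uv with adj G u v
  ... | false = refl

  bad⇒¬adjS : ∀ {u v} → bad u v ≡ true → adj S u v ≡ false
  bad⇒¬adjS {u} {v} uv with adj G u v | adj S u v
  ... | false | false = refl

  private
    record Frame (t : Tour n) (a b x y : Fin n) : Set where
      field
        L C E  : List (Fin n)
        C∷ʳa   : C ++ [ a ] ≡ y ∷ E
        t↭     : order t ↭ a ∷ b ∷ L ++ x ∷ C
        links↭ : links t ↭ cycPairs (a ∷ b ∷ L ++ x ∷ C)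

    frame : (t : Tour n) {a b x y : Fin n} → (a , b) ∈ links t → (x , y) ∈ links t → ¬ x ≡ a → ¬ x ≡ b → Frame t a b x y
    frame t {a} {b} {x} ab∈ xy∈ x≢a x≢b with rotateTo (complete t a)
    ... | r , t↭ , links↭ with successorOfHead a r (Unique-resp-↭ t↭ (unique t)) (∈-resp-↭ links↭ ab∈)
                             | locatePair a r (∈-resp-↭ links↭ xy∈) x≢a
    ...   | E₀ , r∷ʳa | L , C , E , refl , C∷ʳa with L | r∷ʳa
    ...     | []    | eq = ⊥-elim (x≢b (proj₁ (∷-injective eq)))
    ...     | _ ∷ L′ | eq with refl ← proj₁ (∷-injective eq) =
      record { L = L′ ; C = C ; E = E ; C∷ʳa = C∷ʳa ; t↭ = t↭ ; links↭ = links↭ }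

  Lighter : Tour n → Fin n → Fin n → Fin n → Fin n → Tour n → Set
  Lighter t a b x y t′ = ∀ f → (∀ u v → f u v ≡ f v u) → f a x ≡ 0 → f b y ≡ 0 → weight f (links t′) + f a b ≤ weight f (links t)

  -- Replace the links a–b, xₗ–x, x–y of the tour by a–x, x–xₗ, b–y (xₗ the predecessor of x),
  -- i.e. move x in between a and b and reverse the segment b…xₗ.
  exchange : (t : Tour n) → Covers S (order t) → ∀ {a b x y} → (a , b) ∈ links t → (x , y) ∈ links t →
             bad a b ≡ true → adj G a x ≡ true → adj S x y ≡ false →
             ∃[ t′ ] Covers S (order t′) × Lighter t a b x y t′
  exchange t covers {a} {b} {x} {y} ab∈ xy∈ ab-bad ax xy∉S with frame t ab∈ xy∈ x≢a x≢b
    where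
    x≢a : ¬ x ≡ a
    x≢a refl with () ← trans (sym (Graph.irrefl G x)) ax
    x≢b : ¬ x ≡ b
    x≢b refl with () ← trans (sym (bad⇒¬adjG ab-bad)) ax
  ... | record { L = L ; C = C ; E = E ; C∷ʳa = C∷ʳa ; t↭ = t↭ ; links↭ = links↭ } =
    reorder t after (↭-trans t↭ before↭after) , covers′ , lighter
    where
    open ThreeOpt a b L x [] C y E C∷ʳa
    lighter : Lighter t a b x y (reorder t after (↭-trans t↭ before↭after))
    lighter f f-sym ax₀ by₀ = ≤-trans (weight-after+≤ f f-sym ax₀ by₀ (≤-reflexive (f-sym x xₗ)))
                                      (≤-reflexive (sym (weight-↭ f links↭)))
    kept : ∀ p q → adj S p q ≡ true → (p , q) ∈ cycPairs before → CycleEdge after p q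
    kept p q pq pq∈ with ∈-cycPairs-before pq∈
    ... | inj₁ refl                   with () ← trans (sym (bad⇒¬adjS ab-bad)) pq
    ... | inj₂ (inj₁ refl)            = CycleEdge-sym {c = after} yₗ-xₗ-after
    ... | inj₂ (inj₂ (inj₁ refl))     with () ← trans (sym xy∉S) pq
    ... | inj₂ (inj₂ (inj₂ pq∈after)) = pq∈after
    covers′ : Covers S after
    covers′ u v uv with CycleEdge-↭ {c = order t} {c′ = before} links↭ (covers u v uv)
    ... | inj₁ uv∈ = kept u v uv uv∈
    ... | inj₂ vu∈ = CycleEdge-sym {c = after} (kept v u (trans (Graph.sym S v u) uv) vu∈)

  tour-isHamCycle : 3 ≤ n → (t : Tour n) → countPairs bad (links t) ≡ 0 → IsHamCycle (G ⊕ S) (order t)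
  tour-isHamCycle 3≤n t none =
    (subst (3 ≤_) (sym (length-order t)) 3≤n , unique t , λ u v uv∈ → ¬bad⇒adj (countPairs-zero bad (links t) none uv∈)) , complete t
    where
    ¬bad⇒adj : ∀ {u v} → bad u v ≡ false → adj (G ⊕ S) u v ≡ true
    ¬bad⇒adj {u} {v} uv with adj (G ⊕ S) u v
    ... | true = refl

-- Removing the bad links

positive-part : ∀ {c m d} → d ≤ c + m → m < d → 0 < c
positive-part {zero}  d≤m m<d = ⊥-elim (<-irrefl refl (<-≤-trans m<d d≤m))
positive-part {suc c} _   _   = z<s

few-low-bound : ∀ k n L → 30 * k ≤ n → L * (n + 1) < L * (6 * k) + 2 * (k * n) → L < 3 * k
few-low-bound k n L 30k≤n bound = ≰⇒> (λ 3k≤L → <⇒≱ (m+3<12k 3k≤L) 12k≤m+3)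
  where
  open +-*-Solver
  m = n ∸ 6 * k
  n≡6k+m : n ≡ 6 * k + m
  n≡6k+m = sym (m+[n∸m]≡n (≤-trans (*-monoˡ-≤ k (m≤m+n 6 24)) 30k≤n))
  12k≤m+3 : 12 * k ≤ m + 3
  12k≤m+3 = ≤-trans (*-monoˡ-≤ k (m≤m+n 12 12))
              (≤-trans (+-cancelˡ-≤ (6 * k) _ _ (subst₂ _≤_ (solve 1 (λ k → con 30 :* k := con 6 :* k :+ con 24 :* k) refl k) n≡6k+m 30k≤n))
                       (m≤m+n m 3))
  bound′ : L * (m + 1) < 2 * (k * (6 * k + m))
  bound′ = +-cancelˡ-< (L * (6 * k)) _ _ (subst₂ _<_
    (trans (cong (λ z → L * (z + 1)) n≡6k+m)
           (solve 3 (λ L k m → L :* (con 6 :* k :+ m :+ con 1) := L :* (con 6 :* k) :+ L :* (m :+ con 1)) refl L k m))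
    (cong (λ z → L * (6 * k) + 2 * (k * z)) n≡6k+m) bound)
  m+3<12k : 3 * k ≤ L → m + 3 < 12 * k
  m+3<12k 3k≤L = +-cancelʳ-< (2 * m) _ _ (subst (_< 12 * k + 2 * m)
    (solve 1 (λ m → con 3 :* m :+ con 3 := m :+ con 3 :+ con 2 :* m) refl m)
    (*-cancelˡ-< k _ _ (begin-strict
      k * (3 * m + 3)       ≡⟨ solve 2 (λ k m → k :* (con 3 :* m :+ con 3) := con 3 :* k :* (m :+ con 1)) refl k m ⟩
      3 * k * (m + 1)       ≤⟨ *-monoˡ-≤ (m + 1) 3k≤L ⟩
      L * (m + 1)           <⟨ bound′ ⟩
      2 * (k * (6 * k + m)) ≡⟨ solve 2 (λ k m → con 2 :* (k :* (con 6 :* k :+ m)) := k :* (con 12 :* k :+ con 2 :* m)) refl k m ⟩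
      k * (12 * k + 2 * m)  ∎)))
    where open ≤-Reasoning

n+2k<A+B : ∀ n k A B → n + 6 * k ≤ 2 * A → n < 2 * B + k → n + 2 * k < A + B
n+2k<A+B n k A B n+6k≤2A n<2B+k = *-cancelˡ-< 2 _ _ (+-cancelʳ-< k _ _ (begin-strict
  2 * (n + 2 * k) + k   ≤⟨ +-monoʳ-≤ (2 * (n + 2 * k)) (m≤m+n k (k + 0)) ⟩
  2 * (n + 2 * k) + 2 * k ≡⟨ solve 2 (λ n k → con 2 :* (n :+ con 2 :* k) :+ con 2 :* k := n :+ con 6 :* k :+ n) refl n k ⟩
  n + 6 * k + n         <⟨ +-mono-≤-< n+6k≤2A n<2B+k ⟩
  2 * A + (2 * B + k)   ≡⟨ solve 3 (λ A B k → con 2 :* A :+ (con 2 :* B :+ k) := con 2 :* (A :+ B) :+ k) refl A B k ⟩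
  2 * (A + B) + k       ∎))
  where
  open +-*-Solver
  open ≤-Reasoning

positive-order : ∀ {n} (G : Graph n) k → n * n < 2 * numEdges G + k * n → 0 < n
positive-order {zero}  G k lt rewrite *-zeroʳ k = lt
positive-order {suc n} G k _  = z<s

module Construction {n k : ℕ} (G S : Graph n) (k>0 : 0 < k) (60k·n≤2|E| : 60 * k * n ≤ 2 * numEdges G)
  (2|E|≤2deg·n : ∀ v → 2 * numEdges G ≤ 2 * deg G v * n) (n·n<2|E|+k·n : n * n < 2 * numEdges G + k * n)
  (S-linear : IsLinearForest S) (|S|≤k : numEdges S ≤ k) where

  open Exchange G S

  n>0 : 0 < n
  n>0 = positive-order G k n·n<2|E|+k·n

  instance
    n≢0 : NonZero n
    n≢0 = >-nonZero n>0

  n<2deg+k : ∀ v → n < 2 * deg G v + k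
  n<2deg+k v = *-cancelʳ-< n n (2 * deg G v + k)
    (<-≤-trans n·n<2|E|+k·n (≤-trans (+-monoˡ-≤ (k * n) (2|E|≤2deg·n v)) (≤-reflexive (sym (*-distribʳ-+ n (2 * deg G v) k)))))

  30k≤deg : ∀ v → 30 * k ≤ deg G v
  30k≤deg v = *-cancelˡ-≤ 2 (subst (_≤ 2 * deg G v) (*-assoc 2 30 k)
                (*-cancelʳ-≤ (60 * k) (2 * deg G v) n (≤-trans 60k·n≤2|E| (2|E|≤2deg·n v))))

  30k≤n : 30 * k ≤ n
  30k≤n = ≤-trans (30k≤deg (fromℕ< n>0)) (deg≤n G (fromℕ< n>0))

  3≤n : 3 ≤ n
  3≤n = ≤-trans (≤-trans (m≤m+n 3 27) (subst (_≤ 30 * k) (*-identityʳ 30) (*-monoʳ-≤ 30 k>0))) 30k≤n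

  low : Fin n → Bool
  low v = 2 * deg G v <ᵇ n + 6 * k

  low⇒ : ∀ {v} → low v ≡ true → 2 * deg G v < n + 6 * k
  low⇒ {v} eq = <ᵇ⇒< (2 * deg G v) (n + 6 * k) (subst T (sym eq) tt)

  ¬low⇒ : ∀ {v} → low v ≡ false → n + 6 * k ≤ 2 * deg G v
  ¬low⇒ eq = ≮⇒≥ (λ lt → subst T eq (<⇒<ᵇ lt))

  #low : ℕ
  #low = count low (allFin n)

  -- Double counting: vertices of degree below (n + 6k)/2 are few, since the degree sum exceeds n² - kn.
  #low<3k : #low < 3 * k
  #low<3k = few-low-bound k n #low 30k≤n (+-cancelˡ-< (n * (2 * n)) _ _ (begin-strict
    n * (2 * n) + #low * (n + 1)                  ≡⟨ cong (_+ #low * (n + 1)) (solve 1 (λ n → n :* (con 2 :* n) := con 2 :* (n :* n)) refl n) ⟩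
    2 * (n * n) + #low * (n + 1)                  <⟨ +-monoˡ-< _ (*-monoʳ-< 2 n·n<2|E|+k·n) ⟩
    2 * (2 * numEdges G + k * n) + #low * (n + 1)
      ≡⟨ solve 4 (λ E k n L → con 2 :* (E :+ k :* n) :+ L := con 2 :* E :+ L :+ con 2 :* (k :* n)) refl (2 * numEdges G) k n (#low * (n + 1)) ⟩
    2 * (2 * numEdges G) + #low * (n + 1) + 2 * (k * n) ≤⟨ +-monoˡ-≤ _ summed ⟩
    n * (2 * n) + #low * (6 * k) + 2 * (k * n)    ≡⟨ +-assoc (n * (2 * n)) _ _ ⟩
    n * (2 * n) + (#low * (6 * k) + 2 * (k * n))  ∎))
    where
    open ≤-Reasoning
    open +-*-Solver
    all = allFin n
    pointwise : ∀ v → 2 * deg G v + b2n (low v) * (n + 1) ≤ 2 * n + b2n (low v) * (6 * k)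
    pointwise v with low v in eq
    ... | true  = subst₂ _≤_ (solve 2 (λ d n → con 1 :+ con 2 :* d :+ n := con 2 :* d :+ con 1 :* (n :+ con 1)) refl (deg G v) n)
                             (solve 2 (λ n k → n :+ con 6 :* k :+ n := con 2 :* n :+ con 1 :* (con 6 :* k)) refl n k)
                             (+-monoˡ-≤ n (low⇒ eq))
    ... | false = +-mono-≤ (*-monoʳ-≤ 2 (deg≤n G v)) ≤-refl
    summed : 2 * (2 * numEdges G) + #low * (n + 1) ≤ n * (2 * n) + #low * (6 * k)
    summed = subst₂ _≤_
      (trans (sum-map-+ _ _ all) (cong₂ _+_ (trans (sum-map-*ˡ 2 (deg G) all) (cong (2 *_) (handshake G)))
                                             (sum-map-*ʳ (λ v → b2n (low v)) (n + 1) all)))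
      (trans (sum-map-+ _ _ all) (cong₂ _+_ (trans (sum-map-const (2 * n) all) (cong (_* (2 * n)) (length-tabulate {n = n} (λ x → x))))
                                             (sum-map-*ʳ (λ v → b2n (low v)) (6 * k) all)))
      (sum-map-mono _ _ pointwise all)

  touched : Fin n → Bool
  touched v = 0 <ᵇ deg S v

  #touched : ℕ
  #touched = count touched (allFin n)

  #touched≤2k : #touched ≤ 2 * k
  #touched≤2k = begin
    #touched                       ≤⟨ sum-map-mono (λ v → b2n (touched v)) (deg S) (λ v → indicator≤ (deg S v)) (allFin n) ⟩
    sum (map (deg S) (allFin n))   ≡⟨ handshake S ⟩
    2 * numEdges S                 ≤⟨ *-monoʳ-≤ 2 |S|≤k ⟩
    2 * k                          ∎
    where
    open ≤-Reasoning
    indicator≤ : ∀ d → b2n (0 <ᵇ d) ≤ d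
    indicator≤ zero    = z≤n
    indicator≤ (suc d) = s≤s z≤n

  untouched⇒¬adjS : ∀ {v u} → touched v ≡ false → adj S v u ≡ false
  untouched⇒¬adjS {v} {u} untouched with adj S v u in vu
  ... | false = refl
  ... | true with deg S v | adj⇒deg>0 S v u vu
  ...   | suc _ | _ with () ← untouched

  S-links≤2k : (t : Tour n) → countPairs (adj S) (links t) ≤ 2 * k
  S-links≤2k t = begin
    countPairs (adj S) (links t)            ≤⟨ sum-map-mono _ _ pointwise (links t) ⟩
    weight (λ x _ → b2n (touched x)) (links t) ≡⟨ weight-links-proj₁ t (λ x → b2n (touched x)) ⟩
    #touched                                ≤⟨ #touched≤2k ⟩
    2 * k                                   ∎
    where
    open ≤-Reasoning
    pointwise : ∀ ((x , y) : Fin n × Fin n) → b2n (adj S x y) ≤ b2n (touched x)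
    pointwise (x , y) with touched x in tx
    ... | true  = b2n≤1 (adj S x y)
    ... | false rewrite untouched⇒¬adjS {x} {y} tx = z≤n

  lowBad : Fin n → Fin n → Bool
  lowBad u v = bad u v ∧ (low u ∧ low v)

  lowBad-sym : ∀ u v → lowBad u v ≡ lowBad v u
  lowBad-sym u v = cong₂ _∧_ (bad-sym u v) (∧-comm (low u) (low v))

  lowBad⇒bad : ∀ {u v} → lowBad u v ≡ true → bad u v ≡ true
  lowBad⇒bad {u} {v} eq with bad u v
  ... | true = refl

  lowBad-¬low : ∀ {u v} → low v ≡ false → lowBad u v ≡ false
  lowBad-¬low {u} {v} lv rewrite lv | ∧-zeroʳ (low u) = ∧-zeroʳ (bad u v)

  #bad #lowBad : Tour n → ℕ
  #bad t    = countPairs bad (links t)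
  #lowBad t = countPairs lowBad (links t)

  -- a has at least 30k > 2·#low + #touched G-neighbours, so one of them, h, is neither low nor
  -- touched by S and is followed on the tour by a vertex that is not low.
  highUntouchedLink : (t : Tour n) (a : Fin n) →
    ∃[ h ] ∃[ e ] (h , e) ∈ links t × adj G a h ≡ true × low h ≡ false × touched h ≡ false × low e ≡ false
  highUntouchedLink t a =
    extract (countPairs-pos good (links t) (positive-part {countPairs good (links t)} deg≤ (<-≤-trans few (30k≤deg a))))
    where
    good : Fin n → Fin n → Bool
    good h e = adj G a h ∧ (not (low h) ∧ (not (touched h) ∧ not (low e)))
    pointwise : ∀ ((h , e) : Fin n × Fin n) →
                b2n (adj G a h) ≤ b2n (good h e) + (b2n (low h) + b2n (touched h) + b2n (low e))
    pointwise (h , e) with adj G a h | low h | touched h | low e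
    ... | false | _     | _     | _     = z≤n
    ... | true  | true  | _     | _     = s≤s z≤n
    ... | true  | false | true  | _     = s≤s z≤n
    ... | true  | false | false | true  = s≤s z≤n
    ... | true  | false | false | false = s≤s z≤n
    deg≤ : deg G a ≤ countPairs good (links t) + (#low + #touched + #low)
    deg≤ = begin
      deg G a                                 ≡⟨ weight-links-proj₁ t (λ h → b2n (adj G a h)) ⟨
      weight (λ h _ → b2n (adj G a h)) (links t) ≤⟨ sum-map-mono _ _ pointwise (links t) ⟩
      weight (λ h e → b2n (good h e) + (b2n (low h) + b2n (touched h) + b2n (low e))) (links t)
        ≡⟨ sum-map-+ (λ (h , e) → b2n (good h e)) (λ (h , e) → b2n (low h) + b2n (touched h) + b2n (low e)) (links t) ⟩
      countPairs good (links t) + weight (λ h e → b2n (low h) + b2n (touched h) + b2n (low e)) (links t)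
        ≡⟨ cong (countPairs good (links t) +_) split ⟩
      countPairs good (links t) + (#low + #touched + #low) ∎
      where
      open ≤-Reasoning
      split : weight (λ h e → b2n (low h) + b2n (touched h) + b2n (low e)) (links t) ≡ #low + #touched + #low
      split = trans (sum-map-+ (λ (h , e) → b2n (low h) + b2n (touched h)) (λ (h , e) → b2n (low e)) (links t))
                (cong₂ _+_ (trans (sum-map-+ (λ (h , e) → b2n (low h)) (λ (h , e) → b2n (touched h)) (links t))
                                  (cong₂ _+_ (weight-links-proj₁ t (λ h → b2n (low h))) (weight-links-proj₁ t (λ h → b2n (touched h)))))
                           (weight-links-proj₂ t (λ e → b2n (low e))))
    few : #low + #touched + #low < 30 * k
    few = <-≤-trans (+-mono-< (+-mono-<-≤ #low<3k #touched≤2k) #low<3k)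
                    (≤-trans (≤-reflexive (solve 1 (λ k → con 3 :* k :+ con 2 :* k :+ con 3 :* k := con 8 :* k) refl k))
                             (*-monoˡ-≤ k (m≤m+n 8 22)))
      where open +-*-Solver
    extract : ∃[ h ] ∃[ e ] (h , e) ∈ links t × good h e ≡ true →
              ∃[ h ] ∃[ e ] (h , e) ∈ links t × adj G a h ≡ true × low h ≡ false × touched h ≡ false × low e ≡ false
    extract (h , e , he∈ , good-he) with adj G a h in ah | low h in lh | touched h in th | low e in le
    ... | true  | false | false | false = h , e , he∈ , ah , lh , th , le

  fix-lowBad : (t : Tour n) → Covers S (order t) → 0 < #lowBad t →
               ∃[ t′ ] Covers S (order t′) × #lowBad t′ < #lowBad t
  fix-lowBad t covers pos = pick (countPairs-pos lowBad (links t) pos)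
    where
    f : Fin n → Fin n → ℕ
    f u v = b2n (lowBad u v)
    f-sym : ∀ u v → f u v ≡ f v u
    f-sym u v = cong b2n (lowBad-sym u v)
    finish : ∀ {a b h e} → lowBad a b ≡ true → adj G a h ≡ true → low e ≡ false →
             ∃[ t′ ] Covers S (order t′) × Lighter t a b h e t′ → ∃[ t′ ] Covers S (order t′) × #lowBad t′ < #lowBad t
    finish {a} {b} {h} {e} ab ah e-high (t′ , covers′ , lighter) =
      t′ , covers′ , <-≤-trans (m<m+n _ z<s) (subst (λ w → #lowBad t′ + b2n w ≤ #lowBad t) ab (lighter f f-sym fah feb))
      where
      fah : f a h ≡ 0
      fah rewrite adjG⇒¬bad ah = refl
      feb : f b e ≡ 0
      feb = cong b2n (lowBad-¬low e-high)
    pick : ∃[ a ] ∃[ b ] (a , b) ∈ links t × lowBad a b ≡ true → ∃[ t′ ] Covers S (order t′) × #lowBad t′ < #lowBad t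
    pick (a , b , ab∈ , ab) = pick′ (highUntouchedLink t a)
      where
      pick′ : ∃[ h ] ∃[ e ] (h , e) ∈ links t × adj G a h ≡ true × low h ≡ false × touched h ≡ false × low e ≡ false →
              ∃[ t′ ] Covers S (order t′) × #lowBad t′ < #lowBad t
      pick′ (h , e , he∈ , ah , _ , h-untouched , e-high) =
        finish ab ah e-high (exchange t covers ab∈ he∈ (lowBad⇒bad ab) ah (untouched⇒¬adjS h-untouched))

  bad⇒degree-sum : ∀ {a b} → bad a b ≡ true → lowBad a b ≡ false → n + 2 * k < deg G a + deg G b
  bad⇒degree-sum {a} {b} ab ab-notLow = go (low a) refl (low b) refl
    where
    go : ∀ la → low a ≡ la → ∀ lb → low b ≡ lb → n + 2 * k < deg G a + deg G b
    go false la _     _  = n+2k<A+B n k (deg G a) (deg G b) (¬low⇒ la) (n<2deg+k b)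
    go true  _  false lb = subst (n + 2 * k <_) (+-comm (deg G b) (deg G a)) (n+2k<A+B n k (deg G b) (deg G a) (¬low⇒ lb) (n<2deg+k a))
    go true  la true  lb with () ← trans (sym ab-notLow) (cong₂ _∧_ ab (cong₂ _∧_ la lb))

  -- The links x–y of the tour with a ~ x and b ~ y number at least deg a + deg b - n > 2k,
  -- while at most 2k links are S-edges.
  goodLink : (t : Tour n) (a b : Fin n) → n + 2 * k < deg G a + deg G b →
             ∃[ x ] ∃[ y ] (x , y) ∈ links t × adj G a x ≡ true × adj G b y ≡ true × adj S x y ≡ false
  goodLink t a b big =
    extract (countPairs-pos good (links t) (positive-part {countPairs good (links t)} degs≤ big))
    where
    good : Fin n → Fin n → Bool
    good x y = adj G a x ∧ (adj G b y ∧ not (adj S x y))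
    pointwise : ∀ ((x , y) : Fin n × Fin n) → b2n (adj G a x) + b2n (adj G b y) ≤ b2n (good x y) + (1 + b2n (adj S x y))
    pointwise (x , y) with adj G a x | adj G b y | adj S x y
    ... | true  | true  | true  = s≤s (s≤s z≤n)
    ... | true  | true  | false = ≤-refl
    ... | true  | false | _     = s≤s z≤n
    ... | false | true  | _     = s≤s z≤n
    ... | false | false | _     = z≤n
    #links : weight (λ _ _ → 1) (links t) ≡ n
    #links = trans (weight-links-proj₁ t (λ _ → 1)) (trans (sum-map-const 1 (allFin n)) (trans (*-identityʳ _) (length-tabulate {n = n} (λ x → x))))
    degs≤ : deg G a + deg G b ≤ countPairs good (links t) + (n + 2 * k)
    degs≤ = begin
      deg G a + deg G b
        ≡⟨ cong₂ _+_ (weight-links-proj₁ t (λ x → b2n (adj G a x))) (weight-links-proj₂ t (λ y → b2n (adj G b y))) ⟨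
      weight (λ x _ → b2n (adj G a x)) (links t) + weight (λ _ y → b2n (adj G b y)) (links t)
        ≡⟨ sum-map-+ (λ (x , _) → b2n (adj G a x)) (λ (_ , y) → b2n (adj G b y)) (links t) ⟨
      weight (λ x y → b2n (adj G a x) + b2n (adj G b y)) (links t) ≤⟨ sum-map-mono _ _ pointwise (links t) ⟩
      weight (λ x y → b2n (good x y) + (1 + b2n (adj S x y))) (links t)
        ≡⟨ sum-map-+ (λ (x , y) → b2n (good x y)) (λ (x , y) → 1 + b2n (adj S x y)) (links t) ⟩
      countPairs good (links t) + weight (λ x y → 1 + b2n (adj S x y)) (links t)
        ≡⟨ cong (countPairs good (links t) +_) (trans (sum-map-+ (λ _ → 1) (λ (x , y) → b2n (adj S x y)) (links t)) (cong (_+ countPairs (adj S) (links t)) #links)) ⟩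
      countPairs good (links t) + (n + countPairs (adj S) (links t)) ≤⟨ +-monoʳ-≤ (countPairs good (links t)) (+-monoʳ-≤ n (S-links≤2k t)) ⟩
      countPairs good (links t) + (n + 2 * k) ∎
      where open ≤-Reasoning
    extract : ∃[ x ] ∃[ y ] (x , y) ∈ links t × good x y ≡ true →
              ∃[ x ] ∃[ y ] (x , y) ∈ links t × adj G a x ≡ true × adj G b y ≡ true × adj S x y ≡ false
    extract (x , y , xy∈ , good-xy) with adj G a x in ax | adj G b y in by | adj S x y in xy
    ... | true | true | false = x , y , xy∈ , ax , by , xy

  fix-bad : (t : Tour n) → Covers S (order t) × #lowBad t ≡ 0 → 0 < #bad t →
            ∃[ t′ ] (Covers S (order t′) × #lowBad t′ ≡ 0) × #bad t′ < #bad t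
  fix-bad t (covers , noLowBad) pos = pick (countPairs-pos bad (links t) pos)
    where
    fBad fLow : Fin n → Fin n → ℕ
    fBad u v = b2n (bad u v)
    fLow u v = b2n (lowBad u v)
    fBad-sym : ∀ u v → fBad u v ≡ fBad v u
    fBad-sym u v = cong b2n (bad-sym u v)
    fLow-sym : ∀ u v → fLow u v ≡ fLow v u
    fLow-sym u v = cong b2n (lowBad-sym u v)
    adjG⇒fBad≡0 : ∀ {u v} → adj G u v ≡ true → fBad u v ≡ 0
    adjG⇒fBad≡0 uv = cong b2n (adjG⇒¬bad uv)
    adjG⇒fLow≡0 : ∀ {u v} → adj G u v ≡ true → fLow u v ≡ 0
    adjG⇒fLow≡0 {u} {v} uv = cong (λ w → b2n (w ∧ (low u ∧ low v))) (adjG⇒¬bad uv)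
    finish : ∀ {a b x y} → bad a b ≡ true → adj G a x ≡ true → adj G b y ≡ true →
             ∃[ t′ ] Covers S (order t′) × Lighter t a b x y t′ →
             ∃[ t′ ] (Covers S (order t′) × #lowBad t′ ≡ 0) × #bad t′ < #bad t
    finish ab ax by (t′ , covers′ , lighter) =
      t′ , (covers′ , n≤0⇒n≡0 (≤-trans (m≤m+n _ _) (≤-trans (lighter fLow fLow-sym (adjG⇒fLow≡0 ax) (adjG⇒fLow≡0 by))
                                                            (≤-reflexive noLowBad))))
         , <-≤-trans (m<m+n _ z<s) (subst (λ w → #bad t′ + b2n w ≤ #bad t) ab
                                          (lighter fBad fBad-sym (adjG⇒fBad≡0 ax) (adjG⇒fBad≡0 by)))
    pick : ∃[ a ] ∃[ b ] (a , b) ∈ links t × bad a b ≡ true → ∃[ t′ ] (Covers S (order t′) × #lowBad t′ ≡ 0) × #bad t′ < #bad t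
    pick (a , b , ab∈ , ab) = pick′ (goodLink t a b (bad⇒degree-sum ab (countPairs-zero lowBad (links t) noLowBad ab∈)))
      where
      pick′ : ∃[ x ] ∃[ y ] (x , y) ∈ links t × adj G a x ≡ true × adj G b y ≡ true × adj S x y ≡ false →
              ∃[ t′ ] (Covers S (order t′) × #lowBad t′ ≡ 0) × #bad t′ < #bad t
      pick′ (x , y , xy∈ , ax , by , xy∉S) = finish ab ax by (exchange t covers ab∈ xy∈ ab ax xy∉S)

lemma2 : (n k : ℕ) (G S : Graph n)
         → 0 < k
         → 60 * k * n ≤ 2 * numEdges G
         → (∀ v → 2 * numEdges G ≤ 2 * deg G v * n)
         → n * n < 2 * numEdges G + k * n
         → IsLinearForest S
         → numEdges S ≤ k
         → Σ (List (Fin n)) (λ c → IsHamCycle (G ⊕ S) c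
                                   × (∀ u v → adj S u v ≡ true → CycleEdge c u v))
lemma2 n k G S k>0 60k·n≤2|E| 2|E|≤2deg·n n·n<2|E|+k·n S-linear |S|≤k =
  let open Construction G S k>0 60k·n≤2|E| 2|E|≤2deg·n n·n<2|E|+k·n S-linear |S|≤k
      open Exchange G S
      (t₁ , covers₁)               = LinearForestCover.coveringTour S S-linear 3≤n
      (t₂ , covers₂ , noLowBad₂)   = descent #lowBad (λ t → Covers S (order t)) fix-lowBad t₁ covers₁
      (t₃ , (covers₃ , _) , noBad) = descent #bad (λ t → Covers S (order t) × #lowBad t ≡ 0) fix-bad t₂ (covers₂ , noLowBad₂)
  in order t₃ , tour-isHamCycle 3≤n t₃ noBad , covers₃
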